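{- Let $G$ be a $4$-regular graph without a hamiltonian path. Then the $K_4$-inflation $H_G$ of $G$ contains no HIST.
   Context: A HIST of a graph is a spanning tree in which no vertex has degree $2$. For a $4$-regular graph $G$, its $K_4$-inflation $H_G$ is obtained by replacing each vertex $v$ of $G$ with a copy of $K_4$ whose four vertices are in bijection with the four edges of $G$ incident to $v$, and, for each edge $e = uv$ of $G$, adding an edge between the vertex of the $K_4$ of $u$ corresponding to $e$ and the vertex of the $K_4$ of $v$ corresponding to $e$. Thus the new edges are in one-to-one correspondence with the edges of $G$, and $H_G$ is $4$-regular. -}

module Defs where

open import Level using (0ℓ)
open import Data.Nat using (ℕ; _≤_)
open import Data.Fin using (Fin)
open import Data.Product using (Σ; ∃; ∃-syntax; _×_; _,_)
open import Data.Sum using (_⊎_)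
open import Data.List using (List; []; _∷_; _++_; [_]; length)
open import Data.List.Membership.Propositional using (_∈_)
open import Data.List.Relation.Unary.Linked using (Linked)
open import Data.List.Relation.Unary.Unique.Propositional using (Unique)
open import Relation.Binary.Construct.Closure.ReflexiveTransitive using (Star)
open import Relation.Binary.PropositionalEquality using (_≡_; _≢_)
open import Relation.Nullary using (¬_)

record SimpleGraph (n : ℕ) : Set₁ where
  field
    Adj    : Fin n → Fin n → Set
    sym    : ∀ {u v} → Adj u v → Adj v u
    irrefl : ∀ {v} → ¬ Adj v v

-- A 4-regular structure: for every vertex v a bijection between Fin 4
-- and the set of neighbours of v (i.e. deg v = 4).  Index i at v
-- names the edge  v -- nb v i.
record FourRegular {n : ℕ} (G : SimpleGraph n) : Set where
  open SimpleGraph G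
  field
    nb       : Fin n → Fin 4 → Fin n
    nb-adj   : ∀ v i → Adj v (nb v i)
    nb-inj   : ∀ v {i j} → nb v i ≡ nb v j → i ≡ j
    nb-onto  : ∀ v w → Adj v w → ∃[ i ] nb v i ≡ w

HamiltonianPath : ∀ {n} → SimpleGraph n → Set
HamiltonianPath {n} G =
  Σ (List (Fin n)) λ xs →
    Unique xs × (∀ v → v ∈ xs) × Linked (SimpleGraph.Adj G) xs

-- The K4-inflation H_G.  Vertex (v , i) is the vertex of the K4 of v
-- corresponding to the edge v -- nb v i of G.

InflVertex : ℕ → Set
InflVertex n = Fin n × Fin 4

InflAdj : ∀ {n} {G : SimpleGraph n} → FourRegular G →
          InflVertex n → InflVertex n → Set
InflAdj R (v , i) (w , j) =
    (v ≡ w × i ≢ j)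
  ⊎ (FourRegular.nb R v i ≡ w × FourRegular.nb R w j ≡ v)

module _ {W : Set} (Adj : W → W → Set) where

  HasCycle : (W → W → Set) → Set
  HasCycle T = Σ W λ x → Σ (List W) λ xs →
    Unique (x ∷ xs) × 2 ≤ length xs × Linked T (x ∷ xs ++ [ x ])

  record SpanningTree : Set₁ where
    field
      T        : W → W → Set
      T-sym    : ∀ {u v} → T u v → T v u
      T⊆Adj    : ∀ {u v} → T u v → Adj u v
      connected : ∀ u v → Star T u v
      acyclic  : ¬ HasCycle T

  DegreeTwo : (W → W → Set) → W → Set
  DegreeTwo T v = Σ W λ a → Σ W λ b →
    a ≢ b × T v a × T v b × (∀ c → T v c → c ≡ a ⊎ c ≡ b)

  HIST : Set₁
  HIST = Σ SpanningTree λ S → ∀ v → ¬ DegreeTwo (SpanningTree.T S) v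

-- Let S be a HIST of H_G and call a vertex of H_G a port when its edge leaving its K4 lies in S.
-- Inside a K4, S induces a forest in which no vertex has S-degree 0 or 2. An exhaustive check of
-- the 2^10 possible traces (inner tree edges, ports) shows that every component of such a forest
-- carries at most two ports, and that a K4 with three ports has no inner tree edge at all.
-- Joining the ports along outer tree edges and along inner components therefore gives a
-- connected graph of maximum degree two, in which a K4 with three ports would produce three
-- leaves; this is impossible. Hence every vertex of G meets at most two outer tree edges, and
-- these form a connected spanning subgraph of G of maximum degree two: a hamiltonian path.
module Submission where

open import Data.Bool using (Bool; true; false; T; not; _∧_; _∨_)
open import Data.Bool.Properties using (T-∧; T-∨)
open import Data.Empty using (⊥; ⊥-elim)
open import Data.Fin using (Fin; zero; suc)
open import Data.Fin.Properties using (_≟_)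
open import Data.List using (List; []; _∷_; _++_; [_]; allFin; cartesianProduct)
open import Data.List.Membership.Propositional using (_∈_; _∉_; lose)
open import Data.List.Membership.Propositional.Properties
  using (∈-++⁺ˡ; ∈-++⁺ʳ; ∈-allFin; ∈-cartesianProduct⁺)
open import Data.List.Relation.Unary.All using ([]; _∷_)
open import Data.List.Relation.Unary.All.Properties using (¬Any⇒All¬)
open import Data.List.Relation.Unary.AllPairs using ([]; _∷_)
open import Data.List.Relation.Unary.Any using (here; there; any?; satisfied)
open import Data.List.Relation.Unary.Linked using (Linked; []; [-]; _∷_)
import Data.List.Relation.Unary.Linked as Linked
open import Data.List.Relation.Unary.Unique.Propositional using (Unique)
import Data.List.Relation.Unary.Unique.Propositional.Properties as Unique
open import Data.Nat using (ℕ; zero; suc; _<_; _≤_; z≤n; s≤s)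
open import Data.Nat.Properties using (≤-refl; <-≤-trans; m≤n⇒m≤1+n)
open import Data.Product using (∃; ∃₂; _×_; _,_; proj₁; proj₂)
open import Data.Product.Properties using (≡-dec)
open import Data.Sum using (_⊎_; inj₁; inj₂)
open import Data.Unit using (⊤; tt)
open import Data.Vec using (Vec; []; _∷_; lookup; tabulate)
open import Data.Vec.Properties using (lookup∘tabulate)
open import Function using (_∘_)
open import Function.Bundles using (_⇔_; mk⇔; Equivalence)
open import Relation.Binary.Construct.Closure.ReflexiveTransitive using (Star; ε; _◅_; _◅◅_)
open import Relation.Binary.Definitions using (DecidableEquality; Symmetric)
open import Relation.Binary.PropositionalEquality using (_≡_; _≢_; refl; sym; trans; subst; cong; ≢-sym)
open import Relation.Nullary using (¬_; Dec; yes; no; does)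
open import Relation.Nullary.Decidable
  using (⌊_⌋; toWitness; fromWitness; toWitnessFalse; fromWitnessFalse; _×-dec_;
         decidable-stable; dec-false; does-⇔; ¬¬-excluded-middle)
open import Relation.Unary using (Decidable)

open import Defs

open Equivalence using (to; from)

_⇒_ : Bool → Bool → Bool
a ⇒ b = not a ∨ b

infixr 4 _⇒_

T-⇒ : ∀ {a b} → T (a ⇒ b) → T a → T b
T-⇒ {true} h _ = h

T-not⁺ : ∀ {b} → ¬ T b → T (not b)
T-not⁺ {false} _ = tt
T-not⁺ {true}  h = h tt

T-not⁻ : ∀ {b} → T (not b) → ¬ T b
T-not⁻ {false} _ ()

T-does : ∀ {P : Set} (d : Dec P) → T (does d) ⇔ P
T-does (yes p) = mk⇔ (λ _ → p) (λ _ → tt)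
T-does (no ¬p) = mk⇔ (λ ()) ¬p

record Searchable (A : Set) : Set where
  field
    every  : (A → Bool) → Bool
    every⁺ : ∀ p → T (every p) → ∀ a → T (p a)
    every⁻ : ∀ p → (∀ a → T (p a)) → T (every p)

open Searchable ⦃ ... ⦄

some : ∀ {A} ⦃ _ : Searchable A ⦄ → (A → Bool) → Bool
some p = not (every (not ∘ p))

instance
  Bool-searchable : Searchable Bool
  Bool-searchable = record
    { every  = λ p → p true ∧ p false
    ; every⁺ = λ { p h true → proj₁ (T-∧ .to h) ; p h false → proj₂ (T-∧ .to h) }
    ; every⁻ = λ p h → T-∧ .from (h true , h false)
    }

  Fin-searchable : ∀ {n} → Searchable (Fin n)
  Fin-searchable = record { every = everyFin ; every⁺ = everyFin⁺ ; every⁻ = everyFin⁻ }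
    where
      everyFin : ∀ {n} → (Fin n → Bool) → Bool
      everyFin {zero}  p = true
      everyFin {suc n} p = p zero ∧ everyFin (p ∘ suc)
      everyFin⁺ : ∀ {n} p → T (everyFin {n} p) → ∀ a → T (p a)
      everyFin⁺ p h zero    = proj₁ (T-∧ .to h)
      everyFin⁺ p h (suc a) = everyFin⁺ (p ∘ suc) (proj₂ (T-∧ .to h)) a
      everyFin⁻ : ∀ {n} p → (∀ a → T (p a)) → T (everyFin {n} p)
      everyFin⁻ {zero}  p h = tt
      everyFin⁻ {suc n} p h = T-∧ .from (h zero , everyFin⁻ (p ∘ suc) (h ∘ suc))

  ×-searchable : ∀ {A B} → ⦃ Searchable A ⦄ → ⦃ Searchable B ⦄ → Searchable (A × B)
  ×-searchable = record
    { every  = λ p → every λ a → every λ b → p (a , b)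
    ; every⁺ = λ p h (a , b) → every⁺ _ (every⁺ _ h a) b
    ; every⁻ = λ p h → every⁻ _ λ a → every⁻ _ λ b → h (a , b)
    }

  Vec-searchable : ∀ {A n} → ⦃ Searchable A ⦄ → Searchable (Vec A n)
  Vec-searchable {A} = record { every = everyVec ; every⁺ = everyVec⁺ ; every⁻ = everyVec⁻ }
    where
      everyVec : ∀ {n} → (Vec A n → Bool) → Bool
      everyVec {zero}  p = p []
      everyVec {suc n} p = every λ x → everyVec λ xs → p (x ∷ xs)
      everyVec⁺ : ∀ {n} p → T (everyVec {n} p) → ∀ a → T (p a)
      everyVec⁺ p h []       = h
      everyVec⁺ p h (x ∷ xs) = everyVec⁺ _ (every⁺ _ h x) xs
      everyVec⁻ : ∀ {n} p → (∀ a → T (p a)) → T (everyVec {n} p)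
      everyVec⁻ {zero}  p h = h []
      everyVec⁻ {suc n} p h = every⁻ _ λ x → everyVec⁻ _ λ xs → h (x ∷ xs)

-- The premise is evaluated once per a, before the (cheaper) claims are checked.
decide : ∀ {A B} ⦃ _ : Searchable A ⦄ ⦃ _ : Searchable B ⦄ (premise : A → Bool) (claim : A → B → Bool) →
         T (every λ a → premise a ⇒ every (claim a)) → ∀ a → T (premise a) → ∀ b → T (claim a b)
decide premise claim h a pa = every⁺ _ (T-⇒ (every⁺ _ h a) pa)

-- Traces of a spanning tree on one K4: its inner edges, listed as 01 02 03 12 13 23, and its ports.

pattern 0F = zero
pattern 1F = suc zero
pattern 2F = suc (suc zero)
pattern 3F = suc (suc (suc zero))

Fin4³ : Set
Fin4³ = Fin 4 × Fin 4 × Fin 4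

_==_ : Fin 4 → Fin 4 → Bool
i == j = ⌊ i ≟ j ⌋

≢⇒T-not== : ∀ {i j} → i ≢ j → T (not (i == j))
≢⇒T-not== {i} {j} = fromWitnessFalse {a? = i ≟ j}

Edges Ports Config : Set
Edges  = Vec Bool 6
Ports  = Vec Bool 4
Config = Edges × Ports

edge : Edges → Fin 4 → Fin 4 → Bool
edge (e₀₁ ∷ e₀₂ ∷ e₀₃ ∷ e₁₂ ∷ e₁₃ ∷ e₂₃ ∷ []) = λ where
  0F 1F → e₀₁ ; 0F 2F → e₀₂ ; 0F 3F → e₀₃ ; 1F 2F → e₁₂ ; 1F 3F → e₁₃ ; 2F 3F → e₂₃
  1F 0F → e₀₁ ; 2F 0F → e₀₂ ; 3F 0F → e₀₃ ; 2F 1F → e₁₂ ; 3F 1F → e₁₃ ; 3F 2F → e₂₃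
  _  _  → false

fromAdjacency : (Fin 4 → Fin 4 → Bool) → Edges
fromAdjacency f = f 0F 1F ∷ f 0F 2F ∷ f 0F 3F ∷ f 1F 2F ∷ f 1F 3F ∷ f 2F 3F ∷ []

edge-fromAdjacency : ∀ f → (∀ i j → f i j ≡ f j i) → (∀ i → f i i ≡ false) →
                     ∀ i j → edge (fromAdjacency f) i j ≡ f i j
edge-fromAdjacency f f-sym f-irr = λ where
  0F 1F → refl ; 0F 2F → refl ; 0F 3F → refl ; 1F 2F → refl ; 1F 3F → refl ; 2F 3F → refl
  1F 0F → f-sym 0F 1F ; 2F 0F → f-sym 0F 2F ; 3F 0F → f-sym 0F 3F
  2F 1F → f-sym 1F 2F ; 3F 1F → f-sym 1F 3F ; 3F 2F → f-sym 2F 3F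
  0F 0F → sym (f-irr 0F) ; 1F 1F → sym (f-irr 1F) ; 2F 2F → sym (f-irr 2F) ; 3F 3F → sym (f-irr 3F)

port : Ports → Fin 4 → Bool
port = lookup

-- The potential tree edges at i, indexed by Fin 4: index i itself stands for the outer edge.
incident : Config → Fin 4 → Fin 4 → Bool
incident (E , P) i j with i ≟ j
... | yes _ = port P i
... | no _  = edge E i j

exactlyTwo : (Fin 4 → Bool) → Fin 4 × Fin 4 → Bool
exactlyTwo b (j , k) = not (j == k) ∧ b j ∧ b k ∧ every λ l → b l ⇒ l == j ∨ l == k

degreeOK : Config → Bool
degreeOK c = every λ i → some (incident c i) ∧ every λ jk → not (exactlyTwo (incident c i) jk)

-- The cycles of K4 are its triangles and its 4-cycles.
cycleFree : Edges → Bool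
cycleFree E =
  (every λ ((a , b , c) : Fin4³) → not (edge E a b ∧ edge E b c ∧ edge E c a)) ∧
  (every λ ((a , b , c , d) : Fin 4 × Fin4³) →
     not (not (a == c) ∧ not (b == d) ∧ edge E a b ∧ edge E b c ∧ edge E c d ∧ edge E d a))

admissible : Config → Bool
admissible (E , P) = degreeOK (E , P) ∧ cycleFree E

reach : ℕ → Edges → Fin 4 → Fin 4 → Bool
reach zero    E i j = i == j
reach (suc k) E i j = reach k E i j ∨ some λ m → reach k E i m ∧ edge E m j

-- On four vertices, reachability is reachability in at most three steps.
linked : Edges → Fin 4 → Fin 4 → Bool
linked = reach 3

joined : Config → Fin 4 → Fin 4 → Bool
joined (E , P) i j = not (i == j) ∧ port P i ∧ port P j ∧ linked E i j

exactlyTwo⁻ : ∀ b {j k} → T (exactlyTwo b (j , k)) →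
              j ≢ k × T (b j) × T (b k) × (∀ l → T (b l) → l ≡ j ⊎ l ≡ k)
exactlyTwo⁻ b {j} {k} h with T-∧ .to h
... | j≢k , h′ with T-∧ .to h′
... | bj , h″ with T-∧ .to h″
... | bk , only =
  toWitnessFalse {a? = j ≟ k} j≢k , bj , bk ,
  λ l bl → ==-cases (T-⇒ (every⁺ (λ l → b l ⇒ l == j ∨ l == k) only l) bl)
  where
    ==-cases : ∀ {l} → T (l == j ∨ l == k) → l ≡ j ⊎ l ≡ k
    ==-cases {l} h with T-∨ .to h
    ... | inj₁ l≡j = inj₁ (toWitness {a? = l ≟ j} l≡j)
    ... | inj₂ l≡k = inj₂ (toWitness {a? = l ≟ k} l≡k)

linked-refl : ∀ E i → T (linked E i i)
linked-refl E i = reach-refl 3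
  where
    reach-refl : ∀ k → T (reach k E i i)
    reach-refl zero    = fromWitness refl
    reach-refl (suc k) = T-∨ .from (inj₁ (reach-refl k))

linked-step : ∀ E {i a b} → T (linked E i a) → T (edge E a b) → T (linked E i b)
linked-step E {i} {a} {b} ia ab =
  T-⇒ (decide (λ (_ : Edges) → true)
              (λ E ((i , a , b) : Fin4³) → linked E i a ∧ edge E a b ⇒ linked E i b)
              _ E _ (i , a , b))
      (T-∧ .from (ia , ab))

linked-euclidean : ∀ E {i a k} → T (linked E i a) → T (linked E k a) → T (linked E i k)
linked-euclidean E {i} {a} {k} ia ka =
  T-⇒ (decide (λ (_ : Edges) → true)
              (λ E ((i , a , k) : Fin4³) → linked E i a ∧ linked E k a ⇒ linked E i k)
              _ E _ (i , a , k))
      (T-∧ .from (ia , ka))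

linked-sym : ∀ E {i j} → T (linked E i j) → T (linked E j i)
linked-sym E {i} {j} = linked-euclidean E {j} {j} {i} (linked-refl E j)

joined⁺ : ∀ {E P i j} → i ≢ j → T (port P i) → T (port P j) → T (linked E i j) → T (joined (E , P) i j)
joined⁺ i≢j pi pj ij = T-∧ .from (≢⇒T-not== i≢j , T-∧ .from (pi , T-∧ .from (pj , ij)))

joined⁻ : ∀ {E P i j} → T (joined (E , P) i j) → i ≢ j × T (port P i) × T (port P j) × T (linked E i j)
joined⁻ {i = i} {j} h with T-∧ .to h
... | i≢j , h′ with T-∧ .to h′
... | pi , h″ = toWitnessFalse {a? = i ≟ j} i≢j , pi , T-∧ .to h″

joined-sym : ∀ {E P i j} → T (joined (E , P) i j) → T (joined (E , P) j i)
joined-sym {E} {P} {i} {j} h with joined⁻ {E} {P} {i} {j} h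
... | i≢j , pi , pj , ij = joined⁺ {E} {P} {j} {i} (i≢j ∘ sym) pj pi (linked-sym E {i} {j} ij)

joined-unique : ∀ c → T (admissible c) → ∀ {i j k} → T (joined c i j) → T (joined c i k) → j ≡ k
joined-unique c ok {i} {j} {k} ij ik =
  toWitness (T-⇒ (decide admissible (λ c ((i , j , k) : Fin4³) → joined c i j ∧ joined c i k ⇒ j == k)
                         _ c ok (i , j , k))
                 (T-∧ .from (ij , ik)))

three-ports⇒unjoined : ∀ c → T (admissible c) → ∀ {i j k} → i ≢ j → i ≢ k → j ≢ k →
  T (port (proj₂ c) i) → T (port (proj₂ c) j) → T (port (proj₂ c) k) → ∀ l → ¬ T (joined c i l)
three-ports⇒unjoined c ok {i} {j} {k} i≢j i≢k j≢k pi pj pk l =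
  T-not⁻ (T-⇒ (decide admissible
                 (λ c ((i , j , k , l) : Fin 4 × Fin4³) →
                    not (i == j) ∧ not (i == k) ∧ not (j == k) ∧
                    port (proj₂ c) i ∧ port (proj₂ c) j ∧ port (proj₂ c) k ⇒ not (joined c i l))
                 _ c ok (i , j , k , l))
              (T-∧ .from (≢⇒T-not== i≢j , T-∧ .from (≢⇒T-not== i≢k , T-∧ .from (≢⇒T-not== j≢k ,
               T-∧ .from (pi , T-∧ .from (pj , pk)))))))

-- Connected graphs of maximum degree two

lastOf : {A : Set} → A → List A → A
lastOf x []       = x
lastOf x (y ∷ ys) = lastOf y ys

module MaxDegreeTwo
  {W : Set} (_≟W_ : DecidableEquality W) (vertices : List W) (∈-vertices : ∀ w → w ∈ vertices)
  {Node : W → Set} (Node? : Decidable Node)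
  {E : W → W → Set} (E-sym : Symmetric E)
  (connected : ∀ {x y} → Node x → Node y → Star E x y)
  (degree≤2 : ∀ {x a b c} → E x a → E x b → E x c → a ≢ b → a ≢ c → b ≢ c → ⊥)
  where

  open import Data.List.Membership.DecPropositional _≟W_ using (_∈?_; _∉?_)

  Path : List W → Set
  Path xs = Unique xs × Linked E xs

  Interior : List W → W → Set
  Interior xs u = ∃₂ λ a b → a ∈ xs × b ∈ xs × a ≢ b × E u a × E u b

  position : ∀ {h t u} → Path (h ∷ t) → u ∈ h ∷ t → u ≡ h ⊎ u ≡ lastOf h t ⊎ Interior (h ∷ t) u
  position _ (here refl) = inj₁ refl
  position {h} {t₁ ∷ t} (_ ∷ uniq , _ ∷ link) (there u∈) with position (uniq , link) u∈
  ... | inj₂ (inj₁ last) = inj₂ (inj₁ last)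
  ... | inj₂ (inj₂ (a , b , a∈ , b∈ , a≢b , ua , ub)) = inj₂ (inj₂ (a , b , there a∈ , there b∈ , a≢b , ua , ub))
  position {h} {_ ∷ []}    _                                   (there _) | inj₁ refl = inj₂ (inj₁ refl)
  position {h} {_ ∷ s ∷ _} ((_ ∷ h≢s ∷ _) ∷ _ , ht₁ ∷ t₁s ∷ _) (there _) | inj₁ refl =
    inj₂ (inj₂ (h , s , here refl , there (there (here refl)) , h≢s , E-sym ht₁ , t₁s))

  Leaf : W → Set
  Leaf u = ∀ {a b} → E u a → E u b → a ≡ b

  leaf-endpoint : ∀ {h t u} → Path (h ∷ t) → u ∈ h ∷ t → Leaf u → u ≡ h ⊎ u ≡ lastOf h t
  leaf-endpoint path u∈ leaf with position path u∈
  ... | inj₁ first       = inj₁ first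
  ... | inj₂ (inj₁ last) = inj₂ last
  ... | inj₂ (inj₂ (_ , _ , _ , _ , a≢b , ua , ub)) = ⊥-elim (a≢b (leaf ua ub))

  extend : ∀ {xs u z} → Path xs → u ∈ xs → z ∉ xs → E u z →
           ∃ λ ys → Path ys × (∀ {w} → w ∈ xs → w ∈ ys) × z ∈ ys
  extend {h ∷ t} {u} {z} path@(uniq , link) u∈ z∉ uz with position path u∈
  ... | inj₁ refl = z ∷ h ∷ t , (¬Any⇒All¬ _ z∉ ∷ uniq , E-sym uz ∷ link) , there , here refl
  ... | inj₂ (inj₁ refl) =
    h ∷ t ++ [ z ] ,
    (Unique.++⁺ uniq ([] ∷ []) (λ { (z∈ , here refl) → z∉ z∈ }) , snoc-linked link uz) ,
    ∈-++⁺ˡ , ∈-++⁺ʳ (h ∷ t) (here refl)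
    where
      snoc-linked : ∀ {x xs} → Linked E (x ∷ xs) → E (lastOf x xs) z → Linked E (x ∷ xs ++ [ z ])
      snoc-linked {xs = []}    _            xz = xz ∷ [-]
      snoc-linked {xs = _ ∷ _} (xy ∷ link′) yz = xy ∷ snoc-linked link′ yz
  ... | inj₂ (inj₂ (a , b , a∈ , b∈ , a≢b , ua , ub)) =
    ⊥-elim (degree≤2 ua ub uz a≢b (λ a≡z → z∉ (subst (_∈ h ∷ t) a≡z a∈))
                                  (λ b≡z → z∉ (subst (_∈ h ∷ t) b≡z b∈)))

  crossing : ∀ xs {a b} → Star E a b → a ∈ xs → b ∉ xs → ∃₂ λ u z → u ∈ xs × z ∉ xs × E u z
  crossing xs ε a∈ a∉ = ⊥-elim (a∉ a∈)
  crossing xs {a} (_◅_ {j = c} ac rest) a∈ b∉ with c ∈? xs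
  ... | yes c∈ = crossing xs rest c∈ b∉
  ... | no c∉  = a , c , a∈ , c∉ , ac

  unvisited : ∀ xs → (∀ {w} → Node w → w ∈ xs) ⊎ ∃ λ y → Node y × y ∉ xs
  unvisited xs with any? (λ w → Node? w ×-dec w ∉? xs) vertices
  ... | yes found = inj₂ (satisfied found)
  ... | no none   = inj₁ λ {w} nw → decidable-stable (w ∈? xs) λ w∉ → none (lose (∈-vertices w) (nw , w∉))

  missing : List W → List W → ℕ
  missing xs [] = 0
  missing xs (w ∷ ws) with w ∈? xs
  ... | yes _ = missing xs ws
  ... | no _  = suc (missing xs ws)

  missing-antitone : ∀ {xs ys} → (∀ {w} → w ∈ xs → w ∈ ys) → ∀ ws → missing ys ws ≤ missing xs ws
  missing-antitone sub [] = z≤n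
  missing-antitone {xs} {ys} sub (w ∷ ws) with w ∈? xs | w ∈? ys
  ... | yes _  | yes _ = missing-antitone sub ws
  ... | yes w∈ | no w∉ = ⊥-elim (w∉ (sub w∈))
  ... | no _   | yes _ = m≤n⇒m≤1+n (missing-antitone sub ws)
  ... | no _   | no _  = s≤s (missing-antitone sub ws)

  missing-decreases : ∀ {xs ys z} → (∀ {w} → w ∈ xs → w ∈ ys) → z ∈ ys → z ∉ xs →
                      ∀ ws → z ∈ ws → missing ys ws < missing xs ws
  missing-decreases {xs} {ys} sub z∈ z∉ (w ∷ ws) z∈ws with w ∈? xs | w ∈? ys | z∈ws
  ... | yes w∈ | no w∉ | _          = ⊥-elim (w∉ (sub w∈))
  ... | yes w∈ | _     | here refl  = ⊥-elim (z∉ w∈)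
  ... | no _   | no w∉ | here refl  = ⊥-elim (w∉ z∈)
  ... | no _   | yes _ | here refl  = s≤s (missing-antitone sub ws)
  ... | yes _  | yes _ | there z∈′ = missing-decreases sub z∈ z∉ ws z∈′
  ... | no _   | yes _ | there z∈′ = m≤n⇒m≤1+n (missing-decreases sub z∈ z∉ ws z∈′)
  ... | no _   | no _  | there z∈′ = s≤s (missing-decreases sub z∈ z∉ ws z∈′)

  HamiltonianPathOfNodes : Set
  HamiltonianPathOfNodes = ∃ λ xs → Path xs × (∀ {w} → Node w → w ∈ xs)

  grow : ∀ {w₀} → Node w₀ → (fuel : ℕ) → ∀ xs → missing xs vertices < fuel → Path xs → w₀ ∈ xs →
         HamiltonianPathOfNodes
  grow nw₀ (suc fuel) xs (s≤s bound) path w₀∈ with unvisited xs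
  ... | inj₁ covered = xs , path , covered
  ... | inj₂ (y , ny , y∉) with crossing xs (connected nw₀ ny) w₀∈ y∉
  ... | u , z , u∈ , z∉ , uz with extend path u∈ z∉ uz
  ... | ys , path′ , xs⊆ys , z∈ =
    grow nw₀ fuel ys (<-≤-trans (missing-decreases xs⊆ys z∈ z∉ vertices (∈-vertices z)) bound) path′ (xs⊆ys w₀∈)

  hamiltonianPathOfNodes : HamiltonianPathOfNodes
  hamiltonianPathOfNodes with unvisited []
  ... | inj₁ covered      = [] , ([] , []) , covered
  ... | inj₂ (y , ny , _) = grow ny (suc (missing [ y ] vertices)) [ y ] ≤-refl ([] ∷ [] , [-]) (here refl)

  at-most-two-leaves : ∀ {a b c} → Node a → Node b → Node c → a ≢ b → a ≢ c → b ≢ c →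
                       Leaf a → Leaf b → Leaf c → ⊥
  at-most-two-leaves na nb nc a≢b a≢c b≢c la lb lc with hamiltonianPathOfNodes
  ... | [] , _ , covered with () ← covered na
  ... | h ∷ t , path , covered
    with leaf-endpoint path (covered na) la | leaf-endpoint path (covered nb) lb | leaf-endpoint path (covered nc) lc
  ... | inj₁ refl | inj₁ refl | _         = a≢b refl
  ... | inj₂ a≡   | inj₂ b≡   | _         = a≢b (trans a≡ (sym b≡))
  ... | inj₁ refl | inj₂ _    | inj₁ refl = a≢c refl
  ... | inj₁ _    | inj₂ b≡   | inj₂ c≡   = b≢c (trans b≡ (sym c≡))
  ... | inj₂ _    | inj₁ refl | inj₁ refl = b≢c refl
  ... | inj₂ a≡   | inj₁ _    | inj₂ c≡   = a≢c (trans a≡ (sym c≡))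

module Inflation {n} {G : SimpleGraph n} (R : FourRegular G) where
  open SimpleGraph G using (Adj; irrefl) renaming (sym to Adj-sym)
  open FourRegular R

  backIndex : Fin n → Fin 4 → Fin 4
  backIndex v i = proj₁ (nb-onto (nb v i) v (Adj-sym (nb-adj v i)))

  nb-backIndex : ∀ v i → nb (nb v i) (backIndex v i) ≡ v
  nb-backIndex v i = proj₂ (nb-onto (nb v i) v (Adj-sym (nb-adj v i)))

  partner : InflVertex n → InflVertex n
  partner (v , i) = nb v i , backIndex v i

  partner-involutive : ∀ x → partner (partner x) ≡ x
  partner-involutive (v , i) = back (nb-backIndex v i) (nb-backIndex (nb v i) (backIndex v i))
    where
      back : ∀ {w j} → w ≡ v → nb w j ≡ nb v i → (w , j) ≡ (v , i)
      back refl nb≡ = cong (v ,_) (nb-inj v nb≡)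

  nb-irreflexive : ∀ v i → nb v i ≢ v
  nb-irreflexive v i nb≡v = irrefl (subst (Adj v) nb≡v (nb-adj v i))

  partner-≢ : ∀ x → partner x ≢ x
  partner-≢ (v , i) = nb-irreflexive v i ∘ cong proj₁

  InflAdj⇒inner-or-partner : ∀ {v i w j} → InflAdj R (v , i) (w , j) →
                             (v ≡ w × i ≢ j) ⊎ (w , j) ≡ partner (v , i)
  InflAdj⇒inner-or-partner (inj₁ inner) = inj₁ inner
  InflAdj⇒inner-or-partner {v} {i} (inj₂ (refl , nb≡v)) =
    inj₂ (cong (nb v i ,_) (nb-inj (nb v i) (trans nb≡v (sym (nb-backIndex v i)))))

  neighbour : InflVertex n → Fin 4 → InflVertex n
  neighbour (v , i) j with i ≟ j
  ... | yes _ = partner (v , i)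
  ... | no _  = v , j

  neighbour-injective : ∀ x {j k} → neighbour x j ≡ neighbour x k → j ≡ k
  neighbour-injective (v , i) {j} {k} eq with i ≟ j | i ≟ k
  ... | yes refl | yes refl = refl
  ... | yes refl | no _     = ⊥-elim (nb-irreflexive v i (cong proj₁ eq))
  ... | no _     | yes refl = ⊥-elim (nb-irreflexive v i (sym (cong proj₁ eq)))
  ... | no _     | no _     = cong proj₂ eq

  neighbour-self : ∀ x → neighbour x (proj₂ x) ≡ partner x
  neighbour-self (v , i) with i ≟ i
  ... | yes _   = refl
  ... | no i≢i = ⊥-elim (i≢i refl)

  neighbour-other : ∀ v {i j} → i ≢ j → neighbour (v , i) j ≡ (v , j)
  neighbour-other v {i} {j} i≢j with i ≟ j
  ... | yes i≡j = ⊥-elim (i≢j i≡j)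
  ... | no _    = refl

  InflAdj⇒neighbour : ∀ {x y} → InflAdj R x y → ∃ λ j → y ≡ neighbour x j
  InflAdj⇒neighbour {v , i} adj with InflAdj⇒inner-or-partner adj
  ... | inj₁ (refl , i≢j) = _ , sym (neighbour-other v i≢j)
  ... | inj₂ eq           = i , trans eq (sym (neighbour-self (v , i)))

-- A HIST of the inflation yields a hamiltonian path of G

module FromHIST {n} {G : SimpleGraph n} {R : FourRegular G} (S : SpanningTree (InflAdj R))
  (no-degree-two : ∀ x → ¬ DegreeTwo (InflAdj R) (SpanningTree.T S) x)
  (tree? : ∀ x y → Dec (SpanningTree.T S x y))
  where

  open SimpleGraph G using (Adj)
  open FourRegular R
  open SpanningTree S renaming (T to Tree; T-sym to Tree-sym; T⊆Adj to Tree⊆Adj)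
  open Inflation R

  V : Set
  V = InflVertex n

  Port : V → Set
  Port x = Tree x (partner x)

  Port-partner : ∀ {x} → Port x → Port (partner x)
  Port-partner {x} p = subst (Tree (partner x)) (sym (partner-involutive x)) (Tree-sym p)

  Tree⇒inner-or-partner : ∀ {v i w j} → Tree (v , i) (w , j) → (v ≡ w × i ≢ j) ⊎ (w , j) ≡ partner (v , i)
  Tree⇒inner-or-partner = InflAdj⇒inner-or-partner ∘ Tree⊆Adj

  Tree-irreflexive : ∀ {x} → ¬ Tree x x
  Tree-irreflexive {x} t with Tree⇒inner-or-partner t
  ... | inj₁ (_ , i≢i) = i≢i refl
  ... | inj₂ eq        = partner-≢ x (sym eq)

  Tree⇒≢ : ∀ {x y} → Tree x y → x ≢ y
  Tree⇒≢ t refl = Tree-irreflexive t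

  has-tree-neighbour : ∀ x → ∃ (Tree x)
  has-tree-neighbour x = first-step (connected x (partner x)) (partner-≢ x ∘ sym)
    where
      first-step : ∀ {x y} → Star Tree x y → x ≢ y → ∃ (Tree x)
      first-step ε       x≢x = ⊥-elim (x≢x refl)
      first-step (t ◅ _) _   = _ , t

  triangle : ∀ {x y z} → Tree x y → Tree y z → Tree z x → HasCycle (InflAdj R) Tree
  triangle {x} {y} {z} xy yz zx =
    x , y ∷ z ∷ [] ,
    ((Tree⇒≢ xy ∷ ≢-sym (Tree⇒≢ zx) ∷ []) ∷ (Tree⇒≢ yz ∷ []) ∷ [] ∷ []) ,
    s≤s (s≤s z≤n) , xy ∷ yz ∷ zx ∷ [-]

  square : ∀ {x y z w} → x ≢ z → y ≢ w → Tree x y → Tree y z → Tree z w → Tree w x →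
           HasCycle (InflAdj R) Tree
  square {x} {y} {z} {w} x≢z y≢w xy yz zw wx =
    x , y ∷ z ∷ w ∷ [] ,
    ((Tree⇒≢ xy ∷ x≢z ∷ ≢-sym (Tree⇒≢ wx) ∷ []) ∷ (Tree⇒≢ yz ∷ y≢w ∷ []) ∷ (Tree⇒≢ zw ∷ []) ∷ [] ∷ []) ,
    s≤s (s≤s z≤n) , xy ∷ yz ∷ zw ∷ wx ∷ [-]

  edgesAt : Fin n → Edges
  edgesAt v = fromAdjacency λ a b → does (tree? (v , a) (v , b))

  portsAt : Fin n → Ports
  portsAt v = tabulate λ i → does (tree? (v , i) (partner (v , i)))

  configAt : Fin n → Config
  configAt v = edgesAt v , portsAt v

  edge-edgesAt : ∀ v {a b} → T (edge (edgesAt v) a b) ⇔ Tree (v , a) (v , b)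
  edge-edgesAt v {a} {b} =
    subst (λ e → T e ⇔ _) (sym (edge-fromAdjacency _ symmetric irreflexive a b)) (T-does (tree? _ _))
    where
      symmetric : ∀ a b → does (tree? (v , a) (v , b)) ≡ does (tree? (v , b) (v , a))
      symmetric a b = does-⇔ (mk⇔ Tree-sym Tree-sym) (tree? _ _) (tree? _ _)
      irreflexive : ∀ a → does (tree? (v , a) (v , a)) ≡ false
      irreflexive a = dec-false (tree? _ _) Tree-irreflexive

  port-portsAt : ∀ v {i} → T (port (portsAt v) i) ⇔ Port (v , i)
  port-portsAt v {i} =
    subst (λ p → T p ⇔ _) (sym (lookup∘tabulate (λ i → does (tree? (v , i) (partner (v , i)))) i))
      (T-does (tree? _ _))

  incident-configAt : ∀ v {i j} → T (incident (configAt v) i j) ⇔ Tree (v , i) (neighbour (v , i) j)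
  incident-configAt v {i} {j} with i ≟ j
  ... | yes refl = port-portsAt v
  ... | no _     = edge-edgesAt v

  degreeOK-configAt : ∀ v → T (degreeOK (configAt v))
  degreeOK-configAt v =
    every⁻ _ λ i → T-∧ .from (some-incident i , every⁻ _ λ jk → T-not⁺ (not-exactlyTwo i jk))
    where
      some-incident : ∀ i → T (some (incident (configAt v) i))
      some-incident i with has-tree-neighbour (v , i)
      ... | _ , t with InflAdj⇒neighbour (Tree⊆Adj t)
      ... | j , refl = T-not⁺ λ none →
        T-not⁻ (every⁺ (not ∘ incident (configAt v) i) none j) (incident-configAt v {i} {j} .from t)

      not-exactlyTwo : ∀ i jk → ¬ T (exactlyTwo (incident (configAt v) i) jk)
      not-exactlyTwo i (j , k) two with exactlyTwo⁻ (incident (configAt v) i) two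
      ... | j≢k , tj , tk , only = no-degree-two (v , i)
        ( neighbour (v , i) j , neighbour (v , i) k , j≢k ∘ neighbour-injective (v , i)
        , incident-configAt v .to tj , incident-configAt v .to tk , only-two )
        where
          only-two : ∀ y → Tree (v , i) y → y ≡ neighbour (v , i) j ⊎ y ≡ neighbour (v , i) k
          only-two y t with InflAdj⇒neighbour (Tree⊆Adj t)
          ... | l , refl with only l (incident-configAt v {i} {l} .from t)
          ... | inj₁ refl = inj₁ refl
          ... | inj₂ refl = inj₂ refl

  cycleFree-edgesAt : ∀ v → T (cycleFree (edgesAt v))
  cycleFree-edgesAt v = T-∧ .from (every⁻ _ (T-not⁺ ∘ no-triangle) , every⁻ _ (T-not⁺ ∘ no-square))
    where
      E = edgesAt v
      tree : ∀ {a b} → T (edge E a b) → Tree (v , a) (v , b)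
      tree = edge-edgesAt v .to

      no-triangle : ∀ ((a , b , c) : Fin4³) → ¬ T (edge E a b ∧ edge E b c ∧ edge E c a)
      no-triangle (a , b , c) h with T-∧ .to h
      ... | ab , h′ with T-∧ .to h′
      ... | bc , ca = acyclic (triangle (tree {a} {b} ab) (tree {b} {c} bc) (tree {c} {a} ca))

      no-square : ∀ ((a , b , c , d) : Fin 4 × Fin4³) →
        ¬ T (not (a == c) ∧ not (b == d) ∧ edge E a b ∧ edge E b c ∧ edge E c d ∧ edge E d a)
      no-square (a , b , c , d) h with T-∧ .to h
      ... | a≢c , h₁ with T-∧ .to h₁
      ... | b≢d , h₂ with T-∧ .to h₂
      ... | ab , h₃ with T-∧ .to h₃
      ... | bc , h₄ with T-∧ .to h₄
      ... | cd , da = acyclic (square (toWitnessFalse {a? = a ≟ c} a≢c ∘ cong proj₂)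
                                      (toWitnessFalse {a? = b ≟ d} b≢d ∘ cong proj₂)
                                      (tree {a} {b} ab) (tree {b} {c} bc) (tree {c} {d} cd) (tree {d} {a} da))

  admissible-configAt : ∀ v → T (admissible (configAt v))
  admissible-configAt v = T-∧ .from (degreeOK-configAt v , cycleFree-edgesAt v)

  Joined : V → V → Set
  Joined (v , i) (w , j) = v ≡ w × T (joined (configAt v) i j)

  Joined-functional : ∀ {x a b} → Joined x a → Joined x b → a ≡ b
  Joined-functional {v , i} {_ , j} {_ , k} (refl , ij) (refl , ik) =
    cong (v ,_) (joined-unique (configAt v) (admissible-configAt v) {i} {j} {k} ij ik)

  PortEdge : V → V → Set
  PortEdge x y = (Port x × y ≡ partner x) ⊎ Joined x y

  PortEdge-sym : ∀ {x y} → PortEdge x y → PortEdge y x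
  PortEdge-sym {x} (inj₁ (p , refl)) = inj₁ (Port-partner p , sym (partner-involutive x))
  PortEdge-sym {v , i} {_ , j} (inj₂ (refl , ij)) = inj₂ (refl , joined-sym {edgesAt v} {portsAt v} {i} {j} ij)

  PortEdge-degree≤2 : ∀ {x a b c} → PortEdge x a → PortEdge x b → PortEdge x c → a ≢ b → a ≢ c → b ≢ c → ⊥
  PortEdge-degree≤2     (inj₁ (_ , refl)) (inj₁ (_ , refl)) _                 a≢b _   _   = a≢b refl
  PortEdge-degree≤2     (inj₁ (_ , refl)) (inj₂ _)          (inj₁ (_ , refl)) _   a≢c _   = a≢c refl
  PortEdge-degree≤2 {x} (inj₁ _)          (inj₂ xb)         (inj₂ xc)         _   _   b≢c = b≢c (Joined-functional {x} xb xc)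
  PortEdge-degree≤2     (inj₂ _)          (inj₁ (_ , refl)) (inj₁ (_ , refl)) _   _   b≢c = b≢c refl
  PortEdge-degree≤2 {x} (inj₂ xa)         (inj₁ _)          (inj₂ xc)         _   a≢c _   = a≢c (Joined-functional {x} xa xc)
  PortEdge-degree≤2 {x} (inj₂ xa)         (inj₂ xb)         _                 a≢b _   _   = a≢b (Joined-functional {x} xa xb)

  InnerLinked : V → V → Set
  InnerLinked (u , i) (v , a) = u ≡ v × T (linked (edgesAt v) i a)

  join : ∀ {p q} → Port p → Port q → InnerLinked p q → Star PortEdge p q
  join {v , i} {_ , k} pi pk (refl , ik) = edge-or-stay (i ≟ k)
    where
      edge-or-stay : Dec (i ≡ k) → Star PortEdge (v , i) (v , k)
      edge-or-stay (yes refl) = ε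
      edge-or-stay (no i≢k)   =
        inj₂ (refl , joined⁺ {edgesAt v} {portsAt v} {i} {k} i≢k
                       (port-portsAt v .from pi) (port-portsAt v .from pk) ik) ◅ ε

  -- Follow a tree path, remembering a port p inside the current K4 that is linked to the current vertex.
  walk : ∀ {x y p q} → Star Tree x y → Port p → Port q → InnerLinked p x → InnerLinked q y → Star PortEdge p q
  walk {v , a} {p = _ , i} {_ , k} ε pi pk (refl , ia) (refl , ka) =
    join pi pk (refl , linked-euclidean (edgesAt v) {i} {a} {k} ia ka)
  walk {v , a} {p = _ , i} (_◅_ {j = _ , b} t rest) pi pk (refl , ia) qy with Tree⇒inner-or-partner t
  ... | inj₁ (refl , _) =
    walk rest pi pk (refl , linked-step (edgesAt v) {i} {a} {b} ia (edge-edgesAt v {a} {b} .from t)) qy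
  ... | inj₂ refl =
    join pi t (refl , ia) ◅◅ inj₁ (t , refl) ◅ walk rest (Port-partner t) pk (refl , linked-refl _ b) qy

  PortEdge-connected : ∀ {x y} → Port x → Port y → Star PortEdge x y
  PortEdge-connected {v , i} {w , j} px py =
    walk (connected (v , i) (w , j)) px py (refl , linked-refl _ i) (refl , linked-refl _ j)

  vertices : List V
  vertices = cartesianProduct (allFin n) (allFin 4)

  ∈-vertices : ∀ x → x ∈ vertices
  ∈-vertices (v , i) = ∈-cartesianProduct⁺ (∈-allFin v) (∈-allFin i)

  module PortPaths = MaxDegreeTwo (≡-dec _≟_ _≟_) vertices ∈-vertices (λ x → tree? x (partner x))
    PortEdge-sym PortEdge-connected PortEdge-degree≤2

  at-most-two-ports : ∀ v {i j k} → i ≢ j → i ≢ k → j ≢ k → Port (v , i) → Port (v , j) → Port (v , k) → ⊥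
  at-most-two-ports v i≢j i≢k j≢k pi pj pk =
    PortPaths.at-most-two-leaves pi pj pk (i≢j ∘ cong proj₂) (i≢k ∘ cong proj₂) (j≢k ∘ cong proj₂)
      (leaf i≢j i≢k j≢k pi pj pk) (leaf (≢-sym i≢j) j≢k i≢k pj pi pk) (leaf (≢-sym i≢k) (≢-sym j≢k) i≢j pk pi pj)
    where
      unjoined : ∀ {i j k l} → i ≢ j → i ≢ k → j ≢ k → Port (v , i) → Port (v , j) → Port (v , k) →
                 ¬ T (joined (configAt v) i l)
      unjoined {i} {j} {k} {l} i≢j i≢k j≢k pi pj pk =
        three-ports⇒unjoined (configAt v) (admissible-configAt v) i≢j i≢k j≢k
          (port-portsAt v {i} .from pi) (port-portsAt v {j} .from pj) (port-portsAt v {k} .from pk) l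

      leaf : ∀ {i j k} → i ≢ j → i ≢ k → j ≢ k → Port (v , i) → Port (v , j) → Port (v , k) →
             PortPaths.Leaf (v , i)
      leaf i≢j i≢k j≢k pi pj pk (inj₁ (_ , refl)) (inj₁ (_ , refl)) = refl
      leaf i≢j i≢k j≢k pi pj pk (inj₂ (refl , il)) _                = ⊥-elim (unjoined i≢j i≢k j≢k pi pj pk il)
      leaf i≢j i≢k j≢k pi pj pk (inj₁ _)           (inj₂ (refl , il)) = ⊥-elim (unjoined i≢j i≢k j≢k pi pj pk il)

  OuterEdge : Fin n → Fin n → Set
  OuterEdge v w = ∃ λ i → nb v i ≡ w × Port (v , i)

  OuterEdge-sym : ∀ {v w} → OuterEdge v w → OuterEdge w v
  OuterEdge-sym {v} (i , refl , p) = backIndex v i , nb-backIndex v i , Port-partner p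

  OuterEdge⇒Adj : ∀ {v w} → OuterEdge v w → Adj v w
  OuterEdge⇒Adj {v} (i , refl , _) = nb-adj v i

  project : ∀ {x y} → Star Tree x y → Star OuterEdge (proj₁ x) (proj₁ y)
  project ε = ε
  project {v , i} (_◅_ {j = w , j} t rest) with Tree⇒inner-or-partner t
  ... | inj₁ (refl , _) = project rest
  ... | inj₂ refl       = (i , refl , t) ◅ project rest

  OuterEdge-connected : ∀ {v w} → ⊤ → ⊤ → Star OuterEdge v w
  OuterEdge-connected {v} {w} _ _ = project (connected (v , 0F) (w , 0F))

  OuterEdge-degree≤2 : ∀ {v a b c} → OuterEdge v a → OuterEdge v b → OuterEdge v c → a ≢ b → a ≢ c → b ≢ c → ⊥
  OuterEdge-degree≤2 {v} (_ , refl , pi) (_ , refl , pj) (_ , refl , pk) a≢b a≢c b≢c =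
    at-most-two-ports v (a≢b ∘ cong (nb v)) (a≢c ∘ cong (nb v)) (b≢c ∘ cong (nb v)) pi pj pk

  module OuterPaths = MaxDegreeTwo _≟_ (allFin n) ∈-allFin (λ _ → yes tt)
    OuterEdge-sym OuterEdge-connected OuterEdge-degree≤2

  hamiltonianPath : HamiltonianPath G
  hamiltonianPath with OuterPaths.hamiltonianPathOfNodes
  ... | xs , (unique , outer) , covered = xs , unique , (λ v → covered tt) , Linked.map OuterEdge⇒Adj outer

¬¬-∀-Fin : ∀ {k} {P : Fin k → Set} → (∀ i → ¬ ¬ P i) → ¬ ¬ (∀ i → P i)
¬¬-∀-Fin {zero}  _   ¬all = ¬all λ ()
¬¬-∀-Fin {suc k} ¬¬P ¬all = ¬¬P zero λ p₀ → ¬¬-∀-Fin (¬¬P ∘ suc) λ ps → ¬all λ { zero → p₀ ; (suc i) → ps i }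

¬¬-decidable : ∀ {n} (_∼_ : InflVertex n → InflVertex n → Set) → ¬ ¬ (∀ x y → Dec (x ∼ y))
¬¬-decidable _∼_ = ¬¬-∀-InflVertex λ x → ¬¬-∀-InflVertex λ y → ¬¬-excluded-middle
  where
    ¬¬-∀-InflVertex : ∀ {n} {P : InflVertex n → Set} → (∀ x → ¬ ¬ P x) → ¬ ¬ (∀ x → P x)
    ¬¬-∀-InflVertex ¬¬P ¬all = ¬¬-∀-Fin (λ v → ¬¬-∀-Fin λ i → ¬¬P (v , i)) λ all → ¬all λ (v , i) → all v i

-- The tree relation of a HIST need not be decidable, but since the goal is ⊥ we may assume it is.
proposition7 : ∀ {n} (G : SimpleGraph n) (R : FourRegular G) →
    ¬ HamiltonianPath G → ¬ HIST (InflAdj R)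
proposition7 G R no-path (S , no-degree-two) =
  ¬¬-decidable (SpanningTree.T S) λ tree? → no-path (FromHIST.hamiltonianPath {R = R} S no-degree-two tree?)
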